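{- For all integers $n \geq 1$, $P(n) \geq f(n)$ and $Q(n) \geq f(n) + 1$.
   Context: For $A \subseteq \{0,1,2,\ldots\}$, $\partial A = \{z \in A : \{z-1,z+1\} \not\subseteq A\}$, $vol(A)=\sum_{z\in A} z$, $per(A) = \sum_{z \in \partial A} z$ (both $0$ for the empty set), and $A^c = \{0,1,2,\ldots\}\setminus A$. For integers $n\ge 0$, $P(n) = \min\{per(A) : A \subseteq \{0,1,\ldots\},\ vol(A)=n\}$ and $Q(n) = \min\{per(A^c) : A \subseteq \{0,1,\ldots\},\ vol(A) = n\}$. Also $f(n) = \lceil (-1+\sqrt{1+8n})/2 \rceil$. -}

module Defs where

open import Data.Nat using (ℕ; zero; suc; _+_; _*_; _≤_; _≤ᵇ_)
open import Data.Bool using (Bool; true; false; if_then_else_; _∧_; not)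
open import Relation.Binary.PropositionalEquality using (_≡_)

Subset : Set
Subset = ℕ → Bool

BoundedBy : ℕ → Subset → Set
BoundedBy N A = ∀ z → N ≤ z → A z ≡ false

compl : Subset → Subset
compl A z = not (A z)

sumBelow : ℕ → (ℕ → ℕ) → ℕ
sumBelow zero    g = 0
sumBelow (suc N) g = sumBelow N g + g N

ind : Bool → ℕ → ℕ
ind b z = if b then z else 0

-- membership of z - 1 in A (false for z = 0, since -1 ∉ {0,1,...})
predIn : Subset → ℕ → Bool
predIn A zero    = false
predIn A (suc k) = A k

inBoundary : Subset → ℕ → Bool
inBoundary A z = A z ∧ not (predIn A z ∧ A (suc z))

-- vol and per, with the sum truncated at a bound M (all summands with z ≥ M
-- must vanish for this to equal the true infinite sum)
volBelow : ℕ → Subset → ℕ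
volBelow M A = sumBelow M (λ z → ind (A z) z)

perBelow : ℕ → Subset → ℕ
perBelow M A = sumBelow M (λ z → ind (inBoundary A z) z)

-- f(n) = ⌈(-1 + √(1+8n))/2⌉ = least k ≥ 0 with k(k+1) ≥ 2n.
-- Computed by search from k upwards with fuel.
fSearch : ℕ → ℕ → ℕ → ℕ
fSearch n zero       k = k
fSearch n (suc fuel) k = if (2 * n) ≤ᵇ (k * suc k) then k else fSearch n fuel (suc k)

f : ℕ → ℕ
f n = fSearch n (suc n) 0

module Submission where

-- Write Tr(q) = q(q+1).  Since f(n) is the least k with
-- 2n ≤ Tr(k), it suffices to prove, for A ⊆ [0,N) with vol(A) = n,
--   (P)  2·vol(A) ≤ Tr(per(A)),
--   (Q)  2·vol(A) + 2q ≤ Tr(q)  for q = per(A^c)  (i.e. 2·vol(A) ≤ Tr(q - 1)).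
-- Both are proved by scanning z = 0, 1, 2, … and maintaining the inequality
-- for the part of A below the scan point.  A maximal run [a, b] of A has
-- volume (a+b)(b-a+1)/2 and contributes a and b to per(A) (and b+1, together
-- with a-1, to per(A^c)); the arithmetic fact that pays for each new point
-- is that Tr is superadditive, Tr(y) + 2x ≤ Tr(y + x).  While a run is still
-- open the scan carries a "pending" term: the boundary point that closes the
-- run if it stops at the current position.
-- The file first develops Tr and the budget predicate 'Covers', then the
-- characterisation of f, then the two scan invariants, and finally derives
-- corollary7 from the invariants evaluated at the bound N.

open import Defs
open import Data.Nat using (ℕ; zero; suc; _+_; _*_; _∸_; _≤_; _≤ᵇ_; z≤n; s≤s)
open import Data.Nat.Properties
open import Data.Nat.Tactic.RingSolver using (solve-∀)
open import Data.Bool using (Bool; true; false; _∧_; not; T)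
open import Data.Product using (_×_; _,_; proj₂)
open import Data.Sum using (_⊎_; inj₁; inj₂; map₂)
open import Relation.Nullary using (contradiction)
open import Relation.Binary.PropositionalEquality
  using (_≡_; _≢_; refl; sym; trans; cong; subst; subst₂)

Tr : ℕ → ℕ
Tr q = q * suc q

Tr-suc : ∀ x → Tr (suc x) ≡ Tr x + 2 * suc x
Tr-suc = unfolded
  where
  unfolded : ∀ x → suc x * suc (suc x) ≡ x * suc x + 2 * suc x
  unfolded = solve-∀

Tr-mono : ∀ {x y} → x ≤ y → Tr x ≤ Tr y
Tr-mono x≤y = *-mono-≤ x≤y (s≤s x≤y)

Tr-extend : ∀ y x → Tr y + 2 * x ≤ Tr (y + x)
Tr-extend y zero rewrite +-identityʳ y | +-identityʳ (Tr y) = ≤-refl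
Tr-extend y (suc x) = begin
  Tr y + 2 * suc x             ≡⟨ shift (Tr y) x ⟩
  Tr y + 2 * x + 2             ≤⟨ +-monoˡ-≤ 2 (Tr-extend y x) ⟩
  Tr (y + x) + 2               ≤⟨ +-monoʳ-≤ (Tr (y + x)) (*-monoʳ-≤ 2 (s≤s z≤n)) ⟩
  Tr (y + x) + 2 * suc (y + x) ≡⟨ sym (Tr-suc (y + x)) ⟩
  Tr (suc (y + x))             ≡⟨ cong Tr (sym (+-suc y x)) ⟩
  Tr (y + suc x)               ∎
  where
  open ≤-Reasoning
  shift : ∀ a x → a + 2 * suc x ≡ a + 2 * x + 2
  shift = solve-∀

-- Covers q V: a perimeter budget q pays for volume V, i.e. 2V ≤ (q-1)q.
Covers : ℕ → ℕ → Set
Covers q V = 2 * V + 2 * q ≤ Tr q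

Covers-+ : ∀ {y V} x → Covers y V → Covers (y + x) V
Covers-+ {y} {V} x c = begin
  2 * V + 2 * (y + x)   ≡⟨ regroup (2 * V) y x ⟩
  2 * V + 2 * y + 2 * x ≤⟨ +-monoˡ-≤ (2 * x) c ⟩
  Tr y + 2 * x          ≤⟨ Tr-extend y x ⟩
  Tr (y + x)            ∎
  where
  open ≤-Reasoning
  regroup : ∀ a y x → a + 2 * (y + x) ≡ a + 2 * y + 2 * x
  regroup = solve-∀

Covers-mono : ∀ {y y′ V} → y ≤ y′ → Covers y V → Covers y′ V
Covers-mono {y} {y′} {V} y≤y′ c =
  subst (λ q → Covers q V) (m+[n∸m]≡n y≤y′) (Covers-+ {y} {V} (y′ ∸ y) c)

-- Raising the budget by one pays for one more point m ≤ y: this is what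
-- closing a run of A costs in the complement's perimeter.
Covers-absorb : ∀ {y V m} → m ≤ y → Covers y V → Covers (suc y) (V + m)
Covers-absorb {y} {V} {m} m≤y c = begin
  2 * (V + m) + 2 * suc y     ≡⟨ regroup (2 * suc y) V m ⟩
  2 * V + 2 * m + 2 * suc y   ≤⟨ +-monoˡ-≤ (2 * suc y) (+-monoʳ-≤ (2 * V) (*-monoʳ-≤ 2 m≤y)) ⟩
  2 * V + 2 * y + 2 * suc y   ≤⟨ +-monoˡ-≤ (2 * suc y) c ⟩
  Tr y + 2 * suc y            ≡⟨ sym (Tr-suc y) ⟩
  Tr (suc y)                  ∎
  where
  open ≤-Reasoning
  regroup : ∀ a V m → 2 * (V + m) + a ≡ 2 * V + 2 * m + a
  regroup = solve-∀

fSearch-least : ∀ n fuel k p → k ≤ p → 2 * n ≤ Tr p → fSearch n fuel k ≤ p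
fSearch-least n zero       k p k≤p h = k≤p
fSearch-least n (suc fuel) k p k≤p h with (2 * n) ≤ᵇ (k * suc k) in found
... | true  = k≤p
... | false = fSearch-least n fuel (suc k) p (≤∧≢⇒< k≤p k≢p) h
  where
  k≢p : k ≢ p
  k≢p refl = subst T found (≤⇒≤ᵇ h)

f-least : ∀ {n p} → 2 * n ≤ Tr p → f n ≤ p
f-least {n} = fSearch-least n (suc n) 0 _ z≤n

f-below-budget : ∀ {n q} → 1 ≤ n → Covers q n → suc (f n) ≤ q
f-below-budget {suc _} {zero}  _ ()
f-below-budget {n}     {suc r} _ c = s≤s (f-least {n} 2n≤Tr-r)
  where
  c′ : 2 * n + 2 * suc r ≤ Tr r + 2 * suc r
  c′ = subst (2 * n + 2 * suc r ≤_) (Tr-suc r) c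
  2n≤Tr-r : 2 * n ≤ Tr r
  2n≤Tr-r = +-cancelʳ-≤ (2 * suc r) (2 * n) (Tr r) c′

-- If m - 1 and m both lie in A, the run through m - 1 is still open and
-- m - 1 is the boundary point closing it if A were cut off at m.
pending : Subset → ℕ → ℕ
pending A zero    = 0
pending A (suc k) = ind (A k ∧ A (suc k)) k

pending-spec : ∀ A m → pending A m ≡ 0 ⊎ (A m ≡ true × suc (pending A m) ≡ m)
pending-spec A zero = inj₁ refl
pending-spec A (suc k) with A k | A (suc k)
... | false | _     = inj₁ refl
... | true  | false = inj₁ refl
... | true  | true  = inj₂ (refl , refl)

pending-vanishes : ∀ A m → A m ≡ false → pending A m ≡ 0
pending-vanishes A m m∉A with pending-spec A m
... | inj₁ no-run     = no-run
... | inj₂ (m∈A , _) = contradiction (trans (sym m∈A) m∉A) λ ()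

-- Adding the point m to a run whose pending boundary is w (w = 0: no open
-- run, w = m - 1: the run continues) is paid for by counting m instead.
closeRun : ∀ P w m → w ≡ 0 ⊎ suc w ≡ m → Tr (P + w) + 2 * m ≤ Tr (P + m)
closeRun P .0 m (inj₁ refl) rewrite +-identityʳ P = Tr-extend P m
closeRun P w .(suc w) (inj₂ refl) = begin
  Tr (P + w) + 2 * suc w       ≤⟨ +-monoʳ-≤ (Tr (P + w)) (*-monoʳ-≤ 2 (m≤n+m (suc w) P)) ⟩
  Tr (P + w) + 2 * (P + suc w) ≡⟨ cong (λ x → Tr (P + w) + 2 * x) (+-suc P w) ⟩
  Tr (P + w) + 2 * suc (P + w) ≡⟨ sym (Tr-suc (P + w)) ⟩
  Tr (suc (P + w))             ≡⟨ cong Tr (sym (+-suc P w)) ⟩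
  Tr (P + suc w)               ∎
  where open ≤-Reasoning

-- A point m of A is counted either as a boundary point or as the pending
-- boundary of the run continuing to m + 1.
run-counted : ∀ p s m → m ≤ ind (not (p ∧ s)) m + ind s m
run-counted p     true  m = m≤n+m m _
run-counted true  false m = m≤m+n m 0
run-counted false false m = m≤m+n m 0

-- One scan step, for a = [m ∈ A], p = [m-1 ∈ A], s = [m+1 ∈ A].
stepP : (a p s : Bool) (V P w m : ℕ) → w ≡ 0 ⊎ (a ≡ true × suc w ≡ m) →
  2 * V ≤ Tr (P + w) →
  2 * (V + ind a m) ≤ Tr (P + ind (a ∧ not (p ∧ s)) m + ind (a ∧ s) m)
stepP false p s V P .0 m (inj₁ refl) h =
  subst₂ _≤_ (cong (2 *_) (sym (+-identityʳ V))) (cong Tr (sym (+-identityʳ (P + 0)))) h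
stepP false p s V P w m (inj₂ (() , _)) h
stepP true p s V P w m shape h = begin
  2 * (V + m)        ≡⟨ *-distribˡ-+ 2 V m ⟩
  2 * V + 2 * m      ≤⟨ +-monoˡ-≤ (2 * m) h ⟩
  Tr (P + w) + 2 * m ≤⟨ closeRun P w m (map₂ proj₂ shape) ⟩
  Tr (P + m)         ≤⟨ Tr-mono counted ⟩
  Tr (P + ind (not (p ∧ s)) m + ind s m) ∎
  where
  open ≤-Reasoning
  counted : P + m ≤ P + ind (not (p ∧ s)) m + ind s m
  counted = ≤-trans (+-monoʳ-≤ P (run-counted p s m)) (≤-reflexive (sym (+-assoc P _ _)))

-- Invariant after scanning [0, m): the volume of A ∩ [0, m) is paid for by
-- the boundary points of A found so far together with the pending one.
scanP : ∀ A m → 2 * volBelow m A ≤ Tr (perBelow m A + pending A m)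
scanP A zero    = z≤n
scanP A (suc m) =
  stepP (A m) (predIn A m) (A (suc m)) (volBelow m A) (perBelow m A) (pending A m) m
    (pending-spec A m) (scanP A m)

isoperimetric-P : ∀ {N A} → BoundedBy N A → 2 * volBelow N A ≤ Tr (perBelow N A)
isoperimetric-P {N} {A} bounded = subst (λ q → 2 * volBelow N A ≤ Tr q) closed (scanP A N)
  where
  closed : perBelow N A + pending A N ≡ perBelow N A
  closed = trans (cong (perBelow N A +_) (pending-vanishes A N (bounded N ≤-refl)))
                 (+-identityʳ (perBelow N A))

predIn-compl : ∀ A m → predIn A m ≡ true → predIn (compl A) m ≡ false
predIn-compl A (suc k) k∈A rewrite k∈A = refl

ind-≤ : ∀ b m → ind b m ≤ m
ind-≤ true  m = ≤-refl
ind-≤ false m = z≤n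

boundary-after-run : ∀ p pc s m → (p ≡ true → pc ≡ false) →
  ind p m ≤ ind (not (pc ∧ not s)) m
boundary-after-run false pc s m _ = z≤n
boundary-after-run true  pc s m c with c refl
... | refl = ≤-refl

-- One scan step, for a = [m ∈ A], p = [m-1 ∈ A], pc = [m-1 ∈ A^c],
-- s = [m+1 ∈ A]; the budget carries m as pending when m - 1 ∈ A.
stepQ : (a p pc s : Bool) (V Q m : ℕ) → (p ≡ true → pc ≡ false) →
  Covers (Q + ind p m) V →
  Covers (Q + ind (not a ∧ not (pc ∧ not s)) m + ind a (suc m)) (V + ind a m)
stepQ false p pc s V Q m c h =
  subst₂ Covers (sym (+-identityʳ (Q + ind (not (pc ∧ not s)) m))) (sym (+-identityʳ V))
  (Covers-mono {V = V} (+-monoʳ-≤ Q (boundary-after-run p pc s m c)) h)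
stepQ true p pc s V Q m c h = subst (λ q → Covers q (V + m)) reassoc
  (Covers-absorb {V = V} (m≤n+m m Q) (Covers-mono {V = V} (+-monoʳ-≤ Q (ind-≤ p m)) h))
  where
  reassoc : suc (Q + m) ≡ Q + 0 + suc m
  reassoc = sym (trans (cong (_+ suc m) (+-identityʳ Q)) (+-suc Q m))

-- Invariant after scanning [0, m): the boundary points of A^c found so far,
-- plus the pending point m when m - 1 ∈ A, pay for the volume of A ∩ [0, m).
scanQ : ∀ A m → Covers (perBelow m (compl A) + ind (predIn A m) m) (volBelow m A)
scanQ A zero    = z≤n
scanQ A (suc m) =
  stepQ (A m) (predIn A m) (predIn (compl A) m) (A (suc m)) (volBelow m A) (perBelow m (compl A)) m
    (predIn-compl A m) (scanQ A m)

-- (Q): 2·vol(A) ≤ (q - 1)q for q = per(A^c); the point N ∉ A must be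
-- included since it closes the last run of A.
isoperimetric-Q : ∀ {N A} → BoundedBy N A →
  Covers (perBelow (suc N) (compl A)) (volBelow N A)
isoperimetric-Q {N} {A} bounded =
  subst₂ Covers (+-identityʳ (perBelow (suc N) (compl A))) (+-identityʳ (volBelow N A))
  (subst (λ b → Covers (perBelow (suc N) (compl A) + ind b (suc N)) (volBelow N A + ind b N))
    (bounded N ≤-refl) (scanQ A (suc N)))

corollary7 : (n : ℕ) → 1 ≤ n → (N : ℕ) (A : Subset) → BoundedBy N A →
    volBelow N A ≡ n →
    (f n ≤ perBelow N A) × (suc (f n) ≤ perBelow (suc N) (compl A))
corollary7 _ 1≤n N A bounded refl =
  f-least {volBelow N A} (isoperimetric-P bounded) ,
  f-below-budget {volBelow N A} 1≤n (isoperimetric-Q bounded)
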